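{- Let $a,b,e\in\mathbb Z$ with $a\neq 0$ and $e>0$, and let $h_2(j)=aj^2+bj+e$ for $j\in\mathbb Z_{\geq 0}$, where it is assumed that $h_2(j)\geq 0$ for all $j\geq 0$ (so $h_2\in\mathcal H_0$). (1) If $b\geq 0$ then $\operatorname{hdepth}(h_2)\leq 8$. (2) If $b<0$ and $b^2\leq 4ae$, then $\operatorname{hdepth}(h_2)\leq 11$.
   Context: $\mathcal H_0$ denotes the set of functions $h:\mathbb Z_{\geq 0}\to\mathbb Z_{\geq 0}$ with $h(0)>0$. For $h\in\mathcal H_0$ and integers $0\leq k\leq d$, set $\beta_k^d(h)=\sum_{j=0}^k(-1)^{k-j}\binom{d-j}{k-j}h(j)$. The Hilbert depth of $h$ is $\operatorname{hdepth}(h)=\max\{d\in\mathbb Z_{\geq 0}\;:\;\beta_k^d(h)\geq 0\text{ for all }0\leq k\leq d\}$. -}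

module Defs where

open import Data.Nat as ℕ using (ℕ; zero; suc; _∸_)
open import Data.Nat.Combinatorics using (_C_)
open import Data.Integer using (ℤ; +_; -[1+_]; _+_; _*_; _^_; 0ℤ; _≤_)
open import Data.List using (List; map; upTo)
open import Data.List using () renaming (foldr to lfoldr)

sumℤ : List ℤ → ℤ
sumℤ = lfoldr _+_ 0ℤ

β : (h : ℕ → ℤ) (k d : ℕ) → ℤ
β h k d = sumℤ (map (λ j → (-[1+ 0 ] ^ (k ∸ j)) * (+ ((d ∸ j) C (k ∸ j))) * h j) (upTo (suc k)))

-- d belongs to the set whose maximum is hdepth(h):
-- β_k^d(h) ≥ 0 for all 0 ≤ k ≤ d
HdepthAdmissible : (h : ℕ → ℤ) (d : ℕ) → Set
HdepthAdmissible h d = (k : ℕ) → k ℕ.≤ d → 0ℤ ≤ β h k d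

HdepthAtMost : (h : ℕ → ℤ) (m : ℕ) → Set
HdepthAtMost h m = (d : ℕ) → HdepthAdmissible h d → d ℕ.≤ m

h₂ : (a b e : ℤ) → ℕ → ℤ
h₂ a b e j = a * (+ j) ^ 2 + b * (+ j) + e

{-# OPTIONS --safe #-}
-- Summing the Pascal rule termwise gives β_{k+1}^d = β_{k+1}^{d+1} + β_k^d, so if d
-- is admissible then so is every smaller depth, and it suffices to exhibit one
-- inadmissible depth. As β is linear in h, for h = h₂ a b e one computes
--   4 β_1^9 + β_2^9 = -(2b + 3e)     and     β_4^12 + β_7^12 = 90b - 129e,
-- which are negative when b ≥ 0, respectively b < 0 (using e > 0). Hence 9, resp. 12,
-- is not admissible.
module Submission where

open import Defs
open import Algebra.Properties.CommutativeSemigroup as CommSemigroupProperties using ()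
open import Data.Integer using (ℤ; +_; _+_; -_; _*_; _^_; _≤_; _<_; 0ℤ; -1ℤ; 1ℤ)
open import Data.Integer.Properties
  using (+-identityˡ; +-identityʳ; +-assoc; *-zeroʳ; *-identityˡ; *-identityʳ; *-distribˡ-+; *-distribʳ-+;
         +-mono-≤; +-mono-≤-<; *-monoˡ-≤-nonNeg; *-monoˡ-<-pos; neg-mono-≤; <⇒≤; <⇒≢;
         +-commutativeSemigroup; *-commutativeSemigroup)
open import Data.Integer.Tactic.RingSolver using (solve-∀)
open import Data.List using (List; []; _∷_; _++_; [_]; map; upTo)
open import Data.List.Properties using (map-++; map-cong; map-cong-local; upTo-∷ʳ)
open import Data.List.Relation.Unary.All.Properties using (applyUpTo⁺₁)
open import Data.Nat as ℕ using (ℕ; zero; suc; _∸_; z≤n; _≤′_; ≤′-refl; ≤′-step)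
open import Data.Nat.Combinatorics using (_C_; nCk+nC[k+1]≡[n+1]C[k+1])
open import Data.Nat.Properties using (n∸n≡0; +-∸-assoc; ≤-trans; ≤-pred; m≤n⇒m≤1+n; n≤1+n; m≤m+n; ≤⇒≤′; ≰⇒>; _≤?_)
open import Data.Product using (_×_; _,_)
open import Function using (id)
open import Relation.Binary.PropositionalEquality
  using (_≡_; _≢_; refl; sym; trans; cong; cong₂; subst; module ≡-Reasoning)
open import Relation.Nullary using (¬_; yes; no; contradiction)

open CommSemigroupProperties +-commutativeSemigroup using (interchange; xy∙z≈xz∙y)
open CommSemigroupProperties *-commutativeSemigroup using (x∙yz≈y∙xz)

private
  variable
    A : Set
    h f g : ℕ → ℤ
    j k d m : ℕ

sumℤ-++ : (xs ys : List ℤ) → sumℤ (xs ++ ys) ≡ sumℤ xs + sumℤ ys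
sumℤ-++ []       ys = sym (+-identityˡ (sumℤ ys))
sumℤ-++ (x ∷ xs) ys = trans (cong (_+_ x) (sumℤ-++ xs ys)) (sym (+-assoc x _ _))

sumℤ-map-+ : (f g : A → ℤ) (xs : List A) →
             sumℤ (map (λ x → f x + g x) xs) ≡ sumℤ (map f xs) + sumℤ (map g xs)
sumℤ-map-+ f g []       = refl
sumℤ-map-+ f g (x ∷ xs) =
  trans (cong (_+_ (f x + g x)) (sumℤ-map-+ f g xs)) (interchange (f x) (g x) _ _)

sumℤ-map-*ˡ : (c : ℤ) (f : A → ℤ) (xs : List A) →
              sumℤ (map (λ x → c * f x) xs) ≡ c * sumℤ (map f xs)
sumℤ-map-*ˡ c f []       = sym (*-zeroʳ c)
sumℤ-map-*ˡ c f (x ∷ xs) =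
  trans (cong (_+_ (c * f x)) (sumℤ-map-*ˡ c f xs)) (sym (*-distribˡ-+ c (f x) _))

Σ< : ℕ → (ℕ → ℤ) → ℤ
Σ< n f = sumℤ (map f (upTo n))

Σ<-suc : ∀ n (f : ℕ → ℤ) → Σ< (suc n) f ≡ Σ< n f + f n
Σ<-suc n f = begin
  sumℤ (map f (upTo (suc n)))      ≡⟨ cong (λ xs → sumℤ (map f xs)) (sym (upTo-∷ʳ n)) ⟩
  sumℤ (map f (upTo n ++ [ n ]))   ≡⟨ cong sumℤ (map-++ f (upTo n) [ n ]) ⟩
  sumℤ (map f (upTo n) ++ [ f n ]) ≡⟨ sumℤ-++ (map f (upTo n)) [ f n ] ⟩
  Σ< n f + (f n + 0ℤ)              ≡⟨ cong (_+_ (Σ< n f)) (+-identityʳ (f n)) ⟩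
  Σ< n f + f n                     ∎
  where open ≡-Reasoning

Σ<-cong : ∀ n → (∀ {j} → j ℕ.< n → f j ≡ g j) → Σ< n f ≡ Σ< n g
Σ<-cong n f≡g = cong sumℤ (map-cong-local (applyUpTo⁺₁ id n f≡g))

β-coeff : ℕ → ℕ → ℕ → ℤ
β-coeff k d j = -1ℤ ^ (k ∸ j) * + ((d ∸ j) C (k ∸ j))

β-coeff-diagonal : ∀ k d → β-coeff k d k ≡ 1ℤ
β-coeff-diagonal k d rewrite n∸n≡0 k = refl

β-coeff-pascal : j ℕ.≤ k → k ℕ.≤ d → β-coeff (suc k) d j ≡ β-coeff (suc k) (suc d) j + β-coeff k d j
β-coeff-pascal {j} {k} {d} j≤k k≤d
  rewrite +-∸-assoc 1 (≤-trans j≤k k≤d) | +-∸-assoc 1 j≤k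
        | sym (nCk+nC[k+1]≡[n+1]C[k+1] (d ∸ j) (k ∸ j))
  = signed-pascal (-1ℤ ^ (k ∸ j)) (+ ((d ∸ j) C (k ∸ j))) (+ ((d ∸ j) C suc (k ∸ j)))
  where
  signed-pascal : ∀ s p q → -1ℤ * s * q ≡ -1ℤ * s * (p + q) + s * p
  signed-pascal = solve-∀

β-summand : (ℕ → ℤ) → ℕ → ℕ → ℕ → ℤ
β-summand h k d j = β-coeff k d j * h j

β-cong : (∀ j → f j ≡ g j) → ∀ k d → β f k d ≡ β g k d
β-cong f≡g k d = cong sumℤ (map-cong (λ j → cong (_*_ (β-coeff k d j)) (f≡g j)) (upTo (suc k)))

β-+ : ∀ (f g : ℕ → ℤ) k d → β (λ j → f j + g j) k d ≡ β f k d + β g k d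
β-+ f g k d = trans
  (cong sumℤ (map-cong (λ j → *-distribˡ-+ (β-coeff k d j) (f j) (g j)) (upTo (suc k))))
  (sumℤ-map-+ (β-summand f k d) (β-summand g k d) (upTo (suc k)))

β-*ˡ : ∀ c (f : ℕ → ℤ) k d → β (λ j → c * f j) k d ≡ c * β f k d
β-*ˡ c f k d = trans
  (cong sumℤ (map-cong (λ j → x∙yz≈y∙xz (β-coeff k d j) c (f j)) (upTo (suc k))))
  (sumℤ-map-*ˡ c (β-summand f k d) (upTo (suc k)))

β-last : ∀ h k d → β h k d ≡ Σ< k (β-summand h k d) + h k
β-last h k d = trans (Σ<-suc k (β-summand h k d)) (cong (_+_ (Σ< k (β-summand h k d))) last-summand)
  where
  last-summand : β-summand h k d k ≡ h k
  last-summand = trans (cong (_* h k) (β-coeff-diagonal k d)) (*-identityˡ (h k))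

β-pascal : ∀ h → k ℕ.≤ d → β h (suc k) d ≡ β h (suc k) (suc d) + β h k d
β-pascal {k} {d} h k≤d = begin
  β h (suc k) d
    ≡⟨ β-last h (suc k) d ⟩
  Σ< (suc k) (β-summand h (suc k) d) + h (suc k)
    ≡⟨ cong (_+ h (suc k)) lower-summands ⟩
  Σ< (suc k) (β-summand h (suc k) (suc d)) + β h k d + h (suc k)
    ≡⟨ xy∙z≈xz∙y (Σ< (suc k) (β-summand h (suc k) (suc d))) (β h k d) (h (suc k)) ⟩
  Σ< (suc k) (β-summand h (suc k) (suc d)) + h (suc k) + β h k d
    ≡⟨ cong (_+ β h k d) (sym (β-last h (suc k) (suc d))) ⟩
  β h (suc k) (suc d) + β h k d
    ∎
  where
  open ≡-Reasoning
  lower-summands : Σ< (suc k) (β-summand h (suc k) d) ≡ Σ< (suc k) (β-summand h (suc k) (suc d)) + β h k d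
  lower-summands = trans
    (Σ<-cong (suc k) λ {j} j<1+k →
      trans (cong (_* h j) (β-coeff-pascal (≤-pred j<1+k) k≤d))
            (*-distribʳ-+ (h j) (β-coeff (suc k) (suc d) j) (β-coeff k d j)))
    (sumℤ-map-+ (β-summand h (suc k) (suc d)) (β-summand h k d) (upTo (suc k)))

HdepthAdmissible-pred : HdepthAdmissible h (suc d) → HdepthAdmissible h d
HdepthAdmissible-pred adm zero    _     = adm zero z≤n
HdepthAdmissible-pred {h} adm (suc k) 1+k≤d = subst (0ℤ ≤_) (sym (β-pascal h k≤d))
  (+-mono-≤ (adm (suc k) (m≤n⇒m≤1+n 1+k≤d)) (HdepthAdmissible-pred adm k k≤d))
  where k≤d = ≤-trans (n≤1+n k) 1+k≤d

HdepthAdmissible-antitone : m ≤′ d → HdepthAdmissible h d → HdepthAdmissible h m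
HdepthAdmissible-antitone ≤′-refl          adm = adm
HdepthAdmissible-antitone (≤′-step m≤′d) adm = HdepthAdmissible-antitone m≤′d (HdepthAdmissible-pred adm)

¬HdepthAdmissible⇒HdepthAtMost : ¬ HdepthAdmissible h (suc m) → HdepthAtMost h m
¬HdepthAdmissible⇒HdepthAtMost {m = m} ¬adm d adm with d ≤? m
... | yes d≤m = d≤m
... | no  d≰m = contradiction (HdepthAdmissible-antitone (≤⇒≤′ (≰⇒> d≰m)) adm) ¬adm

β-h₂ : ∀ a b e k d → β (h₂ a b e) k d ≡ a * β (λ j → (+ j) ^ 2) k d + b * β +_ k d + e * β (λ _ → 1ℤ) k d
β-h₂ a b e k d = begin
  β (h₂ a b e) k d
    ≡⟨ β-+ (λ j → a * (+ j) ^ 2 + b * + j) (λ _ → e) k d ⟩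
  β (λ j → a * (+ j) ^ 2 + b * + j) k d + β (λ _ → e) k d
    ≡⟨ cong₂ _+_ (β-+ (λ j → a * (+ j) ^ 2) (λ j → b * + j) k d) (β-cong (λ _ → sym (*-identityʳ e)) k d) ⟩
  β (λ j → a * (+ j) ^ 2) k d + β (λ j → b * + j) k d + β (λ _ → e * 1ℤ) k d
    ≡⟨ cong₂ _+_ (cong₂ _+_ (β-*ˡ a (λ j → (+ j) ^ 2) k d) (β-*ˡ b +_ k d)) (β-*ˡ e (λ _ → 1ℤ) k d) ⟩
  a * β (λ j → (+ j) ^ 2) k d + b * β +_ k d + e * β (λ _ → 1ℤ) k d ∎
  where open ≡-Reasoning

-- The numerals in the identities below are the values of β at j ↦ j², j ↦ j and j ↦ 1,
-- which hold by evaluation.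
4*β₁⁹+β₂⁹+2b+3e≡0 : ∀ a b e → + 4 * β (h₂ a b e) 1 9 + β (h₂ a b e) 2 9 + (+ 2 * b + + 3 * e) ≡ 0ℤ
4*β₁⁹+β₂⁹+2b+3e≡0 a b e = trans
  (cong (_+ (+ 2 * b + + 3 * e)) (cong₂ (λ x y → + 4 * x + y) (β-h₂ a b e 1 9) (β-h₂ a b e 2 9)))
  (identity a b e)
  where
  identity : ∀ a b e → + 4 * (a * + 1 + b * + 1 + e * - + 8) + (a * - + 4 + b * - + 6 + e * + 29)
                       + (+ 2 * b + + 3 * e) ≡ 0ℤ
  identity = solve-∀

β₄¹²+β₇¹²+90[-b]+129e≡0 : ∀ a b e → β (h₂ a b e) 4 12 + β (h₂ a b e) 7 12 + (+ 90 * - b + + 129 * e) ≡ 0ℤ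
β₄¹²+β₇¹²+90[-b]+129e≡0 a b e = trans
  (cong (_+ (+ 90 * - b + + 129 * e)) (cong₂ _+_ (β-h₂ a b e 4 12) (β-h₂ a b e 7 12)))
  (identity a b e)
  where
  identity : ∀ a b e → (a * - + 50 + b * - + 98 + e * + 367) + (a * + 50 + b * + 188 + e * - + 496)
                       + (+ 90 * - b + + 129 * e) ≡ 0ℤ
  identity = solve-∀

theorem2p7 : (a b e : ℤ) → a ≢ 0ℤ → 0ℤ < e → ((j : _) → 0ℤ ≤ h₂ a b e j) →
    ((0ℤ ≤ b → HdepthAtMost (h₂ a b e) 8) ×
     (b < 0ℤ → b * b ≤ + 4 * a * e → HdepthAtMost (h₂ a b e) 11))
theorem2p7 a b e _ 0<e _ = hdepth≤8 , λ b<0 _ → hdepth≤11 b<0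
  where
  hdepth≤8 : 0ℤ ≤ b → HdepthAtMost (h₂ a b e) 8
  hdepth≤8 0≤b = ¬HdepthAdmissible⇒HdepthAtMost λ adm →
    <⇒≢ (+-mono-≤-< (+-mono-≤ (*-monoˡ-≤-nonNeg (+ 4) (adm 1 (m≤m+n 1 8))) (adm 2 (m≤m+n 2 7)))
                    (+-mono-≤-< (*-monoˡ-≤-nonNeg (+ 2) 0≤b) (*-monoˡ-<-pos (+ 3) 0<e)))
        (sym (4*β₁⁹+β₂⁹+2b+3e≡0 a b e))

  hdepth≤11 : b < 0ℤ → HdepthAtMost (h₂ a b e) 11
  hdepth≤11 b<0 = ¬HdepthAdmissible⇒HdepthAtMost λ adm →
    <⇒≢ (+-mono-≤-< (+-mono-≤ (adm 4 (m≤m+n 4 8)) (adm 7 (m≤m+n 7 5)))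
                    (+-mono-≤-< (*-monoˡ-≤-nonNeg (+ 90) (neg-mono-≤ (<⇒≤ b<0))) (*-monoˡ-<-pos (+ 129) 0<e)))
        (sym (β₄¹²+β₇¹²+90[-b]+129e≡0 a b e))
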